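{- Let $G_1$ and $G_2$ be two non-isomorphic graphs and $G=G_1+G_2$, and let $q$, $n_1,\ldots,n_t$, $m_1,\ldots,m_{t'}$ be as defined in the context. (i) If $q=0$, then $D(G_1+G_2)=\max\{D(G_1),D(G_2)\}$. (ii) If $q\neq 0$ and $z=\min\big\{\max\{n_1,\ldots,n_q\},\max\{m_1,\ldots,m_q\}\big\}$, then $D(G_1+G_2)\leq \max\{D(G_1),D(G_2)\}+z$.
   Context: All graphs are finite and simple. The join $G_1+G_2$ of graphs $G_1=(V_1,E_1)$, $G_2=(V_2,E_2)$ on disjoint vertex sets has vertex set $V_1\cup V_2$ and edge set $E_1\cup E_2\cup\{uv:u\in V_1,v\in V_2\}$. $D(\cdot)$ is the distinguishing number: the least $r$ such that there is a labeling $\phi:V\to\{1,\ldots,r\}$ preserved by no non-identity automorphism. $G[X]$ is the induced subgraph on $X$; $N_G(v)$ is the neighbourhood of $v$ and $\overline{N_G(v)}=V(G)\setminus N_G(v)$. Partition of $V_1$: choose $v_1\in V_1$, set $A:=\overline{N_G(v_1)}$; while some vertex $v$ of $G$ satisfies $\overline{N_G(v)}\cap A\neq\emptyset$ and $\overline{N_G(v)}\not\subseteq A$, replace $A$ by $A\cup\overline{N_G(v)}$; the final set is $A_1$. Then choose a vertex of $V_1$ outside $A_1$ and repeat to get $A_2$, etc., giving a partition $V_1=A_1\cup\cdots\cup A_k$. The same procedure in $V_2$ gives $V_2=B_1\cup\cdots\cup B_{k'}$. Let $H=\{G[A_1],\ldots,G[A_k]\}$ and $H'=\{G[B_1],\ldots,G[B_{k'}]\}$.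 Partition $H$ into isomorphism classes $\mathcal{A}_1,\ldots,\mathcal{A}_t$ (two members lie in the same class iff they are isomorphic), with $|\mathcal{A}_i|=n_i$, and partition $H'$ into isomorphism classes $\mathcal{B}_1,\ldots,\mathcal{B}_{t'}$ with $|\mathcal{B}_j|=m_j$. Let $q$ be the number of classes $\mathcal{A}_i$ whose members are isomorphic to the members of some class $\mathcal{B}_j$; the classes are indexed so that for $1\leq i\leq q$ the members of $\mathcal{A}_i$ are isomorphic to the members of $\mathcal{B}_i$, and for $i>q$ no member of $\mathcal{A}_i$ is isomorphic to a member of any $\mathcal{B}_j$. -}

module Defs where

open import Data.Nat using (ℕ; zero; suc; _+_; _≤_; _⊔_; _⊓_)
open import Data.Bool using (Bool; true; false; if_then_else_)
open import Data.Fin using (Fin; splitAt; _↑ˡ_; _↑ʳ_; _≟_)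
open import Data.Fin as F using ()
open import Data.Sum using (_⊎_; inj₁; inj₂)
open import Data.Product using (Σ; Σ-syntax; ∃; _×_; _,_; proj₁; proj₂)
open import Relation.Nullary using (¬_)
open import Relation.Nullary.Decidable using (⌊_⌋)
open import Relation.Binary.PropositionalEquality using (_≡_; refl)

record Graph : Set where
  field
    size  : ℕ
    adj   : Fin size → Fin size → Bool
    sym   : ∀ i j → adj i j ≡ adj j i
    irref : ∀ i → adj i i ≡ false
open Graph public

record Iso (G H : Graph) : Set where
  field
    to      : Fin (size G) → Fin (size H)
    from    : Fin (size H) → Fin (size G)
    from-to : ∀ v → from (to v) ≡ v
    to-from : ∀ w → to (from w) ≡ w
    pres    : ∀ u v → adj H (to u) (to v) ≡ adj G u v
open Iso public

Aut : Graph → Set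
Aut G = Iso G G

IsDistinguishing : (G : Graph) {r : ℕ} → (Fin (size G) → Fin r) → Set
IsDistinguishing G φ =
  (σ : Aut G) → (∀ v → φ (to σ v) ≡ φ v) → ∀ v → to σ v ≡ v

Distinguishable : Graph → ℕ → Set
Distinguishable G r = Σ (Fin (size G) → Fin r) (IsDistinguishing G)

IsDistNum : Graph → ℕ → Set
IsDistNum G d = Distinguishable G d × (∀ r → Distinguishable G r → d ≤ r)

-- Join G1 + G2 on vertex set Fin (size G1 + size G2):
-- the first size G1 vertices are V1, the remaining ones are V2.

joinAdj : ∀ {n₁ n₂} → (Fin n₁ → Fin n₁ → Bool) → (Fin n₂ → Fin n₂ → Bool)
        → Fin n₁ ⊎ Fin n₂ → Fin n₁ ⊎ Fin n₂ → Bool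
joinAdj a₁ a₂ (inj₁ x) (inj₁ y) = a₁ x y
joinAdj a₁ a₂ (inj₂ x) (inj₂ y) = a₂ x y
joinAdj a₁ a₂ (inj₁ x) (inj₂ y) = true
joinAdj a₁ a₂ (inj₂ x) (inj₁ y) = true

private
  joinAdj-sym : ∀ {n₁ n₂} (a₁ : Fin n₁ → Fin n₁ → Bool) (a₂ : Fin n₂ → Fin n₂ → Bool)
              → (∀ i j → a₁ i j ≡ a₁ j i) → (∀ i j → a₂ i j ≡ a₂ j i)
              → ∀ p q → joinAdj a₁ a₂ p q ≡ joinAdj a₁ a₂ q p
  joinAdj-sym a₁ a₂ s₁ s₂ (inj₁ x) (inj₁ y) = s₁ x y
  joinAdj-sym a₁ a₂ s₁ s₂ (inj₂ x) (inj₂ y) = s₂ x y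
  joinAdj-sym a₁ a₂ s₁ s₂ (inj₁ x) (inj₂ y) = refl
  joinAdj-sym a₁ a₂ s₁ s₂ (inj₂ x) (inj₁ y) = refl

  joinAdj-irr : ∀ {n₁ n₂} (a₁ : Fin n₁ → Fin n₁ → Bool) (a₂ : Fin n₂ → Fin n₂ → Bool)
              → (∀ i → a₁ i i ≡ false) → (∀ i → a₂ i i ≡ false)
              → ∀ p → joinAdj a₁ a₂ p p ≡ false
  joinAdj-irr a₁ a₂ r₁ r₂ (inj₁ x) = r₁ x
  joinAdj-irr a₁ a₂ r₁ r₂ (inj₂ x) = r₂ x

_⊕_ : Graph → Graph → Graph
G₁ ⊕ G₂ = record
  { size  = size G₁ + size G₂
  ; adj   = λ i j → joinAdj (adj G₁) (adj G₂) (splitAt (size G₁) i) (splitAt (size G₁) j)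
  ; sym   = λ i j → joinAdj-sym (adj G₁) (adj G₂) (sym G₁) (sym G₂)
                      (splitAt (size G₁) i) (splitAt (size G₁) j)
  ; irref = λ i → joinAdj-irr (adj G₁) (adj G₂) (irref G₁) (irref G₂) (splitAt (size G₁) i)
  }

inV₁ : (G₁ G₂ : Graph) → Fin (size G₁) → Fin (size (G₁ ⊕ G₂))
inV₁ G₁ G₂ x = x ↑ˡ size G₂

inV₂ : (G₁ G₂ : Graph) → Fin (size G₂) → Fin (size (G₁ ⊕ G₂))
inV₂ G₁ G₂ y = size G₁ ↑ʳ y

-- The set A grown from a starting vertex v₁ by the paper's procedure.
-- u ∈ \overline{N_G(v)}  iff  adj G v u ≡ false  (note v ∈ \overline{N_G(v)}).
-- Reach G v₁ u : u belongs to the final set A obtained from v₁, i.e. the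
-- least set containing \overline{N_G(v₁)} and closed under the step
-- "if \overline{N_G(v)} meets A, add \overline{N_G(v)} to A".

data Reach (G : Graph) (v₁ : Fin (size G)) : Fin (size G) → Set where
  start : ∀ {u} → adj G v₁ u ≡ false → Reach G v₁ u
  grow  : ∀ {u} (v w : Fin (size G)) → Reach G v₁ w → adj G v w ≡ false
        → adj G v u ≡ false → Reach G v₁ u

record InducedIso (G : Graph) (S : Fin (size G) → Set)
                  (H : Graph) (T : Fin (size H) → Set) : Set where
  field
    ito      : Σ (Fin (size G)) S → Σ (Fin (size H)) T
    ifrom    : Σ (Fin (size H)) T → Σ (Fin (size G)) S
    ifrom-to : ∀ x → proj₁ (ifrom (ito x)) ≡ proj₁ x
    ito-from : ∀ y → proj₁ (ito (ifrom y)) ≡ proj₁ y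
    ipres    : ∀ x y → adj H (proj₁ (ito x)) (proj₁ (ito y)) ≡ adj G (proj₁ x) (proj₁ y)

countFin : (k : ℕ) → (Fin k → Bool) → ℕ
countFin zero    P = 0
countFin (suc k) P = (if P F.zero then 1 else 0) + countFin k (λ i → P (F.suc i))

-- Partition data for one side of the join.
-- emb : Fin m → V(G) is the embedding of that side (V1 or V2).
-- blk assigns to each vertex the index of its part; the parts are exactly
-- the sets produced by the procedure (same part iff reachable), all nonempty.
-- cls assigns to each part its isomorphism class of induced subgraphs.

record SidePartition (G : Graph) {m : ℕ} (emb : Fin m → Fin (size G)) : Set₁ where
  field
    k        : ℕ
    blk      : Fin m → Fin k
    blk-surj : ∀ i → ∃ λ x → blk x ≡ i
    blk-spec : ∀ x y → (blk x ≡ blk y → Reach G (emb x) (emb y))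
                     × (Reach G (emb x) (emb y) → blk x ≡ blk y)

  Part : Fin k → Fin (size G) → Set
  Part i v = Σ (Fin m) λ x → emb x ≡ v × blk x ≡ i

  field
    t        : ℕ
    cls      : Fin k → Fin t
    cls-surj : ∀ c → ∃ λ i → cls i ≡ c
    cls-spec : ∀ i j → (cls i ≡ cls j → InducedIso G (Part i) G (Part j))
                     × (InducedIso G (Part i) G (Part j) → cls i ≡ cls j)

  classSize : Fin t → ℕ
  classSize c = countFin k (λ i → ⌊ cls i ≟ c ⌋)

module _ (G₁ G₂ : Graph) where
  private G = G₁ ⊕ G₂

  SharedA : (P : SidePartition G (inV₁ G₁ G₂)) (Q : SidePartition G (inV₂ G₁ G₂))
          → Fin (SidePartition.t P) → Set
  SharedA P Q c = Σ[ i ∈ Fin (SidePartition.k P) ] Σ[ j ∈ Fin (SidePartition.k Q) ]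
    (SidePartition.cls P i ≡ c × InducedIso G (SidePartition.Part P i) G (SidePartition.Part Q j))

  SharedB : (P : SidePartition G (inV₁ G₁ G₂)) (Q : SidePartition G (inV₂ G₁ G₂))
          → Fin (SidePartition.t Q) → Set
  SharedB P Q c = Σ[ i ∈ Fin (SidePartition.k P) ] Σ[ j ∈ Fin (SidePartition.k Q) ]
    (SidePartition.cls Q j ≡ c × InducedIso G (SidePartition.Part P i) G (SidePartition.Part Q j))

  QZero : SidePartition G (inV₁ G₁ G₂) → SidePartition G (inV₂ G₁ G₂) → Set
  QZero P Q = ∀ c → ¬ SharedA P Q c

  IsMaxSharedA : SidePartition G (inV₁ G₁ G₂) → SidePartition G (inV₂ G₁ G₂) → ℕ → Set
  IsMaxSharedA P Q N =
    (Σ[ c ∈ Fin (SidePartition.t P) ] SharedA P Q c × SidePartition.classSize P c ≡ N)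
    × (∀ c → SharedA P Q c → SidePartition.classSize P c ≤ N)

  IsMaxSharedB : SidePartition G (inV₁ G₁ G₂) → SidePartition G (inV₂ G₁ G₂) → ℕ → Set
  IsMaxSharedB P Q M =
    (Σ[ c ∈ Fin (SidePartition.t Q) ] SharedB P Q c × SidePartition.classSize Q c ≡ M)
    × (∀ c → SharedB P Q c → SidePartition.classSize Q c ≤ M)

module Submission where

open import Defs
open import Data.Nat using (ℕ; _≤_; _<_; _+_; _⊔_; _⊓_; _<?_; s≤s; z≤n)
open import Data.Nat.Properties
  using (≤-antisym; +-identityʳ; +-distribˡ-⊓; ⊔-lub; ⊓-glb; m≤m⊔n; m≤n⊔m; +-cancelˡ-≡; +-monoʳ-<; <⇒≢; <-≤-trans)
open import Data.Bool using (true; false; if_then_else_)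
open import Data.Fin using (Fin; zero; suc; splitAt; _↑ˡ_; _↑ʳ_; toℕ; fromℕ<; inject≤; _≟_)
open import Data.Fin.Properties
  using (splitAt-↑ˡ; splitAt-↑ʳ; splitAt⁻¹-↑ˡ; splitAt⁻¹-↑ʳ; ↑ˡ-injective; ↑ʳ-injective; inject≤-injective; toℕ-fromℕ<)
open import Data.Maybe using (Maybe; just; nothing)
open import Data.Sum using (_⊎_; inj₁; inj₂; [_,_])
open import Data.Product using (Σ; _×_; _,_; proj₁; proj₂)
open import Data.Empty using (⊥-elim)
open import Function using (_∘_)
open import Relation.Nullary using (¬_; yes; no)
open import Relation.Nullary.Decidable using (⌊_⌋)
open import Relation.Binary.PropositionalEquality
  using (_≡_; _≢_; refl; trans; cong; cong₂; subst) renaming (sym to ≡-sym)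

-- An automorphism of G₁ + G₂ preserves non-adjacency, hence maps each block Aᵢ, Bⱼ of the partition onto a
-- block; it can move a vertex of V₁ into V₂ only by carrying some Aᵢ onto an isomorphic Bⱼ. Take
-- distinguishing labelings of G₁ and G₂ with colours below D = max{D(G₁), D(G₂)}. Let r be the rank of a
-- block Aᵢ inside its isomorphism class; if r < N (in particular if Aᵢ is isomorphic to some Bⱼ, as then
-- r < nᵢ ≤ N), recolour the vertices of Aᵢ sharing the colour of a chosen representative with the fresh
-- colour D + r. Fresh colours occur only in V₁, so a colour-preserving automorphism fixes V₁ and V₂ setwise;
-- it also maps each recoloured block to an isomorphic block of the same rank, i.e. to itself. Its
-- restrictions to G₁ and G₂ then preserve the original labelings and are identities. This gives
-- D(G₁ + G₂) ≤ D + N, symmetrically ≤ D + M, and N = 0 works when q = 0; conversely automorphisms of Gᵢ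
-- extend to the join, so D(Gᵢ) ≤ D(G₁ + G₂).

↑ˡ≢↑ʳ : ∀ {m n} (i : Fin m) (j : Fin n) → i ↑ˡ n ≢ m ↑ʳ j
↑ˡ≢↑ʳ {m} {n} i j e
  with trans (≡-sym (splitAt-↑ˡ m i n)) (trans (cong (splitAt m) e) (splitAt-↑ʳ m n j))
... | ()

module _ {G : Graph} where

  inverse : Aut G → Aut G
  inverse σ = record
    { to = from σ ; from = to σ ; from-to = to-from σ ; to-from = from-to σ
    ; pres = λ u v → trans (≡-sym (pres σ (from σ u) (from σ v)))
                           (cong₂ (adj G) (to-from σ u) (to-from σ v)) }

  inverse-maps : (σ : Aut G) {u v : Fin (size G)} → v ≡ to σ u → u ≡ to (inverse σ) v
  inverse-maps σ {u} v≡σu = ≡-sym (trans (cong (from σ) v≡σu) (from-to σ u))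

  Reach-map : (σ : Aut G) {a b : Fin (size G)} → Reach G a b → Reach G (to σ a) (to σ b)
  Reach-map σ {a} (start {u} e) = start (trans (pres σ a u) e)
  Reach-map σ {a} (grow {u} v w r e₁ e₂) =
    grow (to σ v) (to σ w) (Reach-map σ r) (trans (pres σ v w) e₁) (trans (pres σ v u) e₂)

  Aut⇒InducedIso : (σ : Aut G) {S T : Fin (size G) → Set}
                 → (∀ v → S v → T (to σ v)) → (∀ w → T w → S (from σ w)) → InducedIso G S G T
  Aut⇒InducedIso σ S⇒T T⇒S = record
    { ito      = λ (v , s) → to σ v , S⇒T v s
    ; ifrom    = λ (w , t) → from σ w , T⇒S w t
    ; ifrom-to = λ (v , _) → from-to σ v
    ; ito-from = λ (w , _) → to-from σ w
    ; ipres    = λ (v , _) (v' , _) → pres σ v v' }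

  InducedIso-sym : {S T : Fin (size G) → Set} → InducedIso G S G T → InducedIso G T G S
  InducedIso-sym I = record
    { ito = ifrom ; ifrom = ito ; ifrom-to = ito-from ; ito-from = ifrom-to
    ; ipres = λ x y → trans (≡-sym (ipres (ifrom x) (ifrom y)))
                            (cong₂ (adj G) (ito-from x) (ito-from y)) }
    where open InducedIso I


ReachClosed : (G : Graph) {m : ℕ} → (Fin m → Fin (size G)) → Set
ReachClosed G {m} e = ∀ x {u} → Reach G (e x) u → Σ (Fin m) λ x' → e x' ≡ u

module _ {G : Graph} where
  open SidePartition using (Part; blk-spec)

  private variable
    mA mB : ℕ
    eA : Fin mA → Fin (size G)
    eB : Fin mB → Fin (size G)

  -- Blocks are Reach-classes, and automorphisms preserve Reach.
  Part-map : (ΠA : SidePartition G eA) (ΠB : SidePartition G eB) (σ : Aut G) → ReachClosed G eB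
           → ∀ {i j v₀ v} → Part ΠA i v₀ → Part ΠB j (to σ v₀) → Part ΠA i v → Part ΠB j (to σ v)
  Part-map ΠA ΠB σ closedB (x₀ , refl , b₀) (y₀ , e₀ , c₀) (x , refl , b) =
    let x₀⇝x    = proj₁ (blk-spec ΠA x₀ x) (trans b₀ (≡-sym b))
        y₀⇝σx   = subst (λ z → Reach G z _) (≡-sym e₀) (Reach-map σ x₀⇝x)
        (y , ey) = closedB y₀ y₀⇝σx
    in y , ey , trans (≡-sym (proj₂ (blk-spec ΠB y₀ y) (subst (Reach G _) (≡-sym ey) y₀⇝σx))) c₀

  Part-map-InducedIso : (ΠA : SidePartition G eA) (ΠB : SidePartition G eB) (σ : Aut G)
                      → ReachClosed G eA → ReachClosed G eB → ∀ {i j v₀}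
                      → Part ΠA i v₀ → Part ΠB j (to σ v₀) → InducedIso G (Part ΠA i) G (Part ΠB j)
  Part-map-InducedIso ΠA ΠB σ closedA closedB {v₀ = v₀} p q =
    Aut⇒InducedIso σ (λ _ → Part-map ΠA ΠB σ closedB p q)
      (λ _ → Part-map ΠB ΠA (inverse σ) closedA q (subst (Part ΠA _) (≡-sym (from-to σ v₀)) p))

record Join (G : Graph) : Set₁ where
  field
    L R           : Graph
    inL           : Fin (size L) → Fin (size G)
    inR           : Fin (size R) → Fin (size G)
    inL-injective : ∀ a b → inL a ≡ inL b → a ≡ b
    inR-injective : ∀ a b → inR a ≡ inR b → a ≡ b
    adj-inL       : ∀ a b → adj G (inL a) (inL b) ≡ adj L a b
    adj-inR       : ∀ a b → adj G (inR a) (inR b) ≡ adj R a b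
    adj-inL-inR   : ∀ a b → adj G (inL a) (inR b) ≡ true
    cover         : ∀ u → (Σ (Fin (size L)) λ x → inL x ≡ u) ⊎ (Σ (Fin (size R)) λ y → inR y ≡ u)
    inL≢inR       : ∀ a b → inL a ≢ inR b

swap : {G : Graph} → Join G → Join G
swap {G} J = record
  { L = R ; R = L ; inL = inR ; inR = inL
  ; inL-injective = inR-injective ; inR-injective = inL-injective
  ; adj-inL = adj-inR ; adj-inR = adj-inL
  ; adj-inL-inR = λ a b → trans (Graph.sym G (inR a) (inL b)) (adj-inL-inR b a)
  ; cover = λ u → [ inj₂ , inj₁ ] (cover u)
  ; inL≢inR = λ a b e → inL≢inR b a (≡-sym e) }
  where open Join J

join-⊕ : (G₁ G₂ : Graph) → Join (G₁ ⊕ G₂)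
join-⊕ G₁ G₂ = record
  { L = G₁ ; R = G₂ ; inL = inV₁ G₁ G₂ ; inR = inV₂ G₁ G₂
  ; inL-injective = ↑ˡ-injective n₂
  ; inR-injective = ↑ʳ-injective n₁
  ; adj-inL = λ a b → cong₂ adj₁₂ (splitAt-↑ˡ n₁ a n₂) (splitAt-↑ˡ n₁ b n₂)
  ; adj-inR = λ a b → cong₂ adj₁₂ (splitAt-↑ʳ n₁ n₂ a) (splitAt-↑ʳ n₁ n₂ b)
  ; adj-inL-inR = λ a b → cong₂ adj₁₂ (splitAt-↑ˡ n₁ a n₂) (splitAt-↑ʳ n₁ n₂ b)
  ; cover = cover
  ; inL≢inR = ↑ˡ≢↑ʳ }
  where
    n₁ = size G₁
    n₂ = size G₂
    adj₁₂ = joinAdj (adj G₁) (adj G₂)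
    cover : ∀ u → (Σ (Fin n₁) λ x → x ↑ˡ n₂ ≡ u) ⊎ (Σ (Fin n₂) λ y → n₁ ↑ʳ y ≡ u)
    cover u with splitAt n₁ u in eq
    ... | inj₁ x = inj₁ (x , splitAt⁻¹-↑ˡ eq)
    ... | inj₂ y = inj₂ (y , splitAt⁻¹-↑ʳ eq)

module JoinProperties {G : Graph} (J : Join G) where
  open Join J

  elim : (P : Fin (size G) → Set) → (∀ x → P (inL x)) → (∀ y → P (inR y)) → ∀ u → P u
  elim P f g u with cover u
  ... | inj₁ (x , e) = subst P e (f x)
  ... | inj₂ (y , e) = subst P e (g y)

  nonadjacent-inL : ∀ x v → adj G (inL x) v ≡ false → Σ (Fin (size L)) λ x' → inL x' ≡ v
  nonadjacent-inL x v e with cover v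
  ... | inj₁ x'-e = x'-e
  ... | inj₂ (y , refl) with trans (≡-sym e) (adj-inL-inR x y)
  ...   | ()

  inL-closed : ReachClosed G inL
  inL-closed x (start e) = nonadjacent-inL x _ e
  inL-closed x (grow {u} v w x⇝w vw vu) =
    let (x₁ , e₁) = inL-closed x x⇝w
        (x₂ , e₂) = nonadjacent-inL x₁ v (trans (cong (λ z → adj G z v) e₁) (trans (Graph.sym G w v) vw))
    in nonadjacent-inL x₂ u (trans (cong (λ z → adj G z u) e₂) vu)

  KeepsL : Aut G → Set
  KeepsL σ = ∀ x → Σ (Fin (size L)) λ x' → inL x' ≡ to σ (inL x)

  restrictL : (σ : Aut G) → KeepsL σ → KeepsL (inverse σ) → Aut L
  restrictL σ k k⁻ = record
    { to      = λ x → proj₁ (k x)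
    ; from    = λ x → proj₁ (k⁻ x)
    ; from-to = λ x → inL-injective _ _ (trans (proj₂ (k⁻ (proj₁ (k x))))
                        (trans (cong (from σ) (proj₂ (k x))) (from-to σ (inL x))))
    ; to-from = λ x → inL-injective _ _ (trans (proj₂ (k (proj₁ (k⁻ x))))
                        (trans (cong (to σ) (proj₂ (k⁻ x))) (to-from σ (inL x))))
    ; pres    = λ u v → trans (≡-sym (adj-inL _ _))
                  (trans (cong₂ (adj G) (proj₂ (k u)) (proj₂ (k v)))
                    (trans (pres σ (inL u) (inL v)) (adj-inL u v))) }

  fixes-inL : ∀ {r} {φ : Fin (size L) → Fin r} → IsDistinguishing L φ
            → (σ : Aut G) (k : KeepsL σ) → KeepsL (inverse σ)
            → (∀ x → φ (proj₁ (k x)) ≡ φ x) → ∀ x → to σ (inL x) ≡ inL x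
  fixes-inL φ-dist σ k k⁻ φ-pres x =
    trans (≡-sym (proj₂ (k x))) (cong inL (φ-dist (restrictL σ k k⁻) φ-pres x))

  extendL-fun : (Fin (size L) → Fin (size L)) → Fin (size G) → Fin (size G)
  extendL-fun f u = [ (λ (x , _) → inL (f x)) , (λ (y , _) → inR y) ] (cover u)

  extendL-fun-inL : ∀ f x → extendL-fun f (inL x) ≡ inL (f x)
  extendL-fun-inL f x with cover (inL x)
  ... | inj₁ (x' , e) = cong (inL ∘ f) (inL-injective _ _ e)
  ... | inj₂ (y , e)  = ⊥-elim (inL≢inR x y (≡-sym e))

  extendL-fun-inR : ∀ f y → extendL-fun f (inR y) ≡ inR y
  extendL-fun-inR f y with cover (inR y)
  ... | inj₁ (x , e)  = ⊥-elim (inL≢inR x y e)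
  ... | inj₂ (y' , e) = e

  extendL-fun-inverse : ∀ f g → (∀ x → g (f x) ≡ x) → ∀ u → extendL-fun g (extendL-fun f u) ≡ u
  extendL-fun-inverse f g gf = elim _
    (λ x → trans (cong (extendL-fun g) (extendL-fun-inL f x))
             (trans (extendL-fun-inL g (f x)) (cong inL (gf x))))
    (λ y → trans (cong (extendL-fun g) (extendL-fun-inR f y)) (extendL-fun-inR g y))

  extendL-fun-pres : (τ : Aut L) → ∀ u v → adj G (extendL-fun (to τ) u) (extendL-fun (to τ) v) ≡ adj G u v
  extendL-fun-pres τ = elim _
    (λ x → elim _
      (λ x' → trans (cong₂ (adj G) (extendL-fun-inL (to τ) x) (extendL-fun-inL (to τ) x'))
                (trans (adj-inL _ _) (trans (pres τ x x') (≡-sym (adj-inL x x')))))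
      (λ y → trans (cong₂ (adj G) (extendL-fun-inL (to τ) x) (extendL-fun-inR (to τ) y))
                (trans (adj-inL-inR _ _) (≡-sym (adj-inL-inR x y)))))
    (λ y → elim _
      (λ x → trans (cong₂ (adj G) (extendL-fun-inR (to τ) y) (extendL-fun-inL (to τ) x))
               (trans (Graph.sym G _ _)
                 (trans (adj-inL-inR _ _) (≡-sym (trans (Graph.sym G _ _) (adj-inL-inR x y))))))
      (λ y' → cong₂ (adj G) (extendL-fun-inR (to τ) y) (extendL-fun-inR (to τ) y')))

  extendL : Aut L → Aut G
  extendL τ = record
    { to      = extendL-fun (to τ)
    ; from    = extendL-fun (from τ)
    ; from-to = extendL-fun-inverse (to τ) (from τ) (from-to τ)
    ; to-from = extendL-fun-inverse (from τ) (to τ) (to-from τ)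
    ; pres    = extendL-fun-pres τ }

  distinguishable-L : ∀ {r} → Distinguishable G r → Distinguishable L r
  distinguishable-L (ψ , ψ-dist) = ψ ∘ inL , λ τ ψ-pres x →
    inL-injective _ _ (trans (≡-sym (extendL-fun-inL (to τ) x))
                             (ψ-dist (extendL τ) (extendL-preserves τ ψ-pres) (inL x)))
    where
      extendL-preserves : ∀ τ → (∀ x → ψ (inL (to τ x)) ≡ ψ (inL x))
                        → ∀ u → ψ (extendL-fun (to τ) u) ≡ ψ u
      extendL-preserves τ ψ-pres = elim _
        (λ x → trans (cong ψ (extendL-fun-inL (to τ) x)) (ψ-pres x))
        (λ y → cong ψ (extendL-fun-inR (to τ) y))

  distNum-L≤ : ∀ {d d₁} → IsDistNum G d → IsDistNum L d₁ → d₁ ≤ d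
  distNum-L≤ (dist , _) (_ , minimal₁) = minimal₁ _ (distinguishable-L dist)

classRank : ∀ {k t} → (Fin k → Fin t) → Fin k → ℕ
classRank c zero    = 0
classRank c (suc i) = (if ⌊ c zero ≟ c (suc i) ⌋ then 1 else 0) + classRank (c ∘ suc) i

classRank<classSize : ∀ {k t} (c : Fin k → Fin t) (i : Fin k)
                    → classRank c i < countFin k (λ j → ⌊ c j ≟ c i ⌋)
classRank<classSize c zero with c zero ≟ c zero
... | yes _  = s≤s z≤n
... | no c≢c = ⊥-elim (c≢c refl)
classRank<classSize c (suc i) =
  +-monoʳ-< (if ⌊ c zero ≟ c (suc i) ⌋ then 1 else 0) (classRank<classSize (c ∘ suc) i)

classRank-injective : ∀ {k t} (c : Fin k → Fin t) (i i' : Fin k)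
                    → c i ≡ c i' → classRank c i ≡ classRank c i' → i ≡ i'
classRank-injective c zero    zero     _ _ = refl
classRank-injective c zero    (suc i') e r with c zero ≟ c (suc i')
... | yes _ = ⊥-elim (<⇒≢ (s≤s z≤n) r)
... | no ≢  = ⊥-elim (≢ e)
classRank-injective c (suc i) zero     e r with c zero ≟ c (suc i)
... | yes _ = ⊥-elim (<⇒≢ (s≤s z≤n) (≡-sym r))
... | no ≢  = ⊥-elim (≢ (≡-sym e))
classRank-injective c (suc i) (suc i') e r =
  cong suc (classRank-injective (c ∘ suc) i i' e
    (+-cancelˡ-≡ (indicator (c (suc i))) _ _
      (trans r (cong (λ z → indicator z + classRank (c ∘ suc) i') (≡-sym e)))))
  where indicator = λ z → if ⌊ c zero ≟ z ⌋ then 1 else 0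

module JoinLabeling {G : Graph} (J : Join G)
  (Π : SidePartition G (Join.inL J)) (Π' : SidePartition G (Join.inR J))
  {d d' D : ℕ} (Φ : Distinguishable (Join.L J) d) (Φ' : Distinguishable (Join.R J) d')
  (d≤D : d ≤ D) (d'≤D : d' ≤ D) (N : ℕ)
  (shared-classRank< : ∀ i j → InducedIso G (SidePartition.Part Π i) G (SidePartition.Part Π' j)
                     → classRank (SidePartition.cls Π) i < N)
  where

  open Join J
  open SidePartition Π
  module JL = JoinProperties J
  module JR = JoinProperties (swap J)

  φ : Fin (size L) → Fin D
  φ x = inject≤ (proj₁ Φ x) d≤D

  φ' : Fin (size R) → Fin D
  φ' y = inject≤ (proj₁ Φ' y) d'≤D

  rank : Fin k → ℕ
  rank = classRank cls

  rep : Fin k → Fin (size L)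
  rep i = proj₁ (blk-surj i)

  blk-rep : ∀ i → blk (rep i) ≡ i
  blk-rep i = proj₂ (blk-surj i)

  low : Fin D → Fin (D + N)
  low c = c ↑ˡ N

  high : Fin N → Fin (D + N)
  high r = D ↑ʳ r

  mark : Fin k → Maybe (Fin N)
  mark i with rank i <? N
  ... | yes rank<N = just (fromℕ< rank<N)
  ... | no _       = nothing

  mark-just : ∀ i → rank i < N → Σ (Fin N) λ r → mark i ≡ just r
  mark-just i rank<N with rank i <? N
  ... | yes rank<N' = fromℕ< rank<N' , refl
  ... | no rank≮N   = ⊥-elim (rank≮N rank<N)

  mark-rank : ∀ i {r} → mark i ≡ just r → toℕ r ≡ rank i
  mark-rank i e with rank i <? N
  mark-rank i refl | yes rank<N = toℕ-fromℕ< rank<N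

  markedLabel : Maybe (Fin N) → Fin D → Fin D → Fin (D + N)
  markedLabel nothing  a c = low c
  markedLabel (just r) a c = if ⌊ c ≟ a ⌋ then high r else low c

  markedLabel-rep : ∀ r a → markedLabel (just r) a a ≡ high r
  markedLabel-rep r a with a ≟ a
  ... | yes _  = refl
  ... | no a≢a = ⊥-elim (a≢a refl)

  markedLabel≡high : ∀ m a c r → markedLabel m a c ≡ high r → m ≡ just r
  markedLabel≡high nothing   a c r e = ⊥-elim (↑ˡ≢↑ʳ c r e)
  markedLabel≡high (just r') a c r e with c ≟ a
  ... | yes _ = cong just (↑ʳ-injective D r' r e)
  ... | no _  = ⊥-elim (↑ˡ≢↑ʳ c r e)

  markedLabel-injective : ∀ m {a a' c c'} → (∀ {r} → m ≡ just r → a ≡ a')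
                        → markedLabel m a c ≡ markedLabel m a' c' → c ≡ c'
  markedLabel-injective nothing _ e = ↑ˡ-injective N _ _ e
  markedLabel-injective (just r) {a} {c = c} {c'} a≡a' e with refl ← a≡a' refl | c ≟ a | c' ≟ a
  ... | yes c≡a | yes c'≡a = trans c≡a (≡-sym c'≡a)
  ... | yes _   | no _     = ⊥-elim (↑ˡ≢↑ʳ c' r (≡-sym e))
  ... | no _    | yes _    = ⊥-elim (↑ˡ≢↑ʳ c r e)
  ... | no _    | no _     = ↑ˡ-injective N c c' e

  labelL : Fin (size L) → Fin (D + N)
  labelL x = markedLabel (mark (blk x)) (φ (rep (blk x))) (φ x)

  labelR : Fin (size R) → Fin (D + N)
  labelR y = low (φ' y)

  label : Fin (size G) → Fin (D + N)
  label u = [ (λ (x , _) → labelL x) , (λ (y , _) → labelR y) ] (cover u)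

  label-inL : ∀ x → label (inL x) ≡ labelL x
  label-inL x with cover (inL x)
  ... | inj₁ (x' , e) = cong labelL (inL-injective _ _ e)
  ... | inj₂ (y , e)  = ⊥-elim (inL≢inR x y (≡-sym e))

  label-inR : ∀ y → label (inR y) ≡ labelR y
  label-inR y with cover (inR y)
  ... | inj₁ (x , e)  = ⊥-elim (inL≢inR x y e)
  ... | inj₂ (y' , e) = cong labelR (inR-injective _ _ e)

  label-rep : ∀ i {r} → mark i ≡ just r → label (inL (rep i)) ≡ high r
  label-rep i {r} e rewrite label-inL (rep i) | blk-rep i | e = markedLabel-rep r (φ (rep i))

  Preserves : Aut G → Set
  Preserves ρ = ∀ u → label (to ρ u) ≡ label u

  module _ (ρ : Aut G) (ρ-pres : Preserves ρ) where

    label-map : ∀ {u v} → v ≡ to ρ u → label v ≡ label u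
    label-map {u} refl = ρ-pres u

    mark-map : ∀ {x x' r} → inL x' ≡ to ρ (inL x) → mark (blk x) ≡ just r → mark (blk x') ≡ just r
    mark-map {x} {x'} {r} e mx =
      let i = blk x
          (x₂ , e₂ , b₂) = Part-map Π Π ρ JL.inL-closed (x , refl , refl) (x' , e , refl) (rep i , refl , blk-rep i)
          labelL-x₂ = trans (≡-sym (label-inL x₂)) (trans (label-map e₂) (label-rep i mx))
      in subst (λ b → mark b ≡ just r) b₂ (markedLabel≡high (mark (blk x₂)) _ (φ x₂) r labelL-x₂)

    keepsL : JL.KeepsL ρ
    keepsL x with cover (to ρ (inL x))
    ... | inj₁ x'-e = x'-e
    ... | inj₂ (y , e) =
      let i = blk x
          shared = Part-map-InducedIso Π Π' ρ JL.inL-closed JR.inL-closed (x , refl , refl) (y , e , refl)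
          (r , mi) = mark-just i (shared-classRank< i _ shared)
          (y₂ , e₂ , _) = Part-map Π Π' ρ JR.inL-closed (x , refl , refl) (y , e , refl) (rep i , refl , blk-rep i)
      in ⊥-elim (↑ˡ≢↑ʳ (φ' y₂) r
           (trans (≡-sym (label-inR y₂)) (trans (label-map e₂) (label-rep i mi))))

  Preserves-inverse : ∀ ρ → Preserves ρ → Preserves (inverse ρ)
  Preserves-inverse ρ ρ-pres u = trans (≡-sym (ρ-pres (from ρ u))) (cong label (to-from ρ u))

  module _ (ρ : Aut G) (ρ-pres : Preserves ρ) where
    private
      ρ⁻-pres = Preserves-inverse ρ ρ-pres

    mark-invariant : ∀ {x x'} → inL x' ≡ to ρ (inL x) → mark (blk x') ≡ mark (blk x)
    mark-invariant {x} {x'} e with mark (blk x) in mx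
    ... | just r  = mark-map ρ ρ-pres e mx
    ... | nothing with mark (blk x') in mx'
    ...   | nothing = refl
    ...   | just r with () ← trans (≡-sym mx) (mark-map (inverse ρ) ρ⁻-pres (inverse-maps ρ e) mx')

    marked-block : ∀ {x x' r} → inL x' ≡ to ρ (inL x) → mark (blk x) ≡ just r → blk x' ≡ blk x
    marked-block {x} {x'} e mx = ≡-sym (classRank-injective cls (blk x) (blk x') same-class same-rank)
      where
        same-class = proj₂ (cls-spec (blk x) (blk x'))
          (Part-map-InducedIso Π Π ρ JL.inL-closed JL.inL-closed (x , refl , refl) (x' , e , refl))
        same-rank = trans (≡-sym (mark-rank (blk x) mx)) (mark-rank (blk x') (mark-map ρ ρ-pres e mx))

    keepsL-φ : ∀ {x x'} → inL x' ≡ to ρ (inL x) → proj₁ Φ x' ≡ proj₁ Φ x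
    keepsL-φ {x} {x'} e = inject≤-injective d≤D d≤D _ _
      (markedLabel-injective (mark (blk x)) (λ mx → cong (φ ∘ rep) (marked-block e mx))
        (subst (λ m → markedLabel m _ (φ x') ≡ labelL x) (mark-invariant e)
          (trans (≡-sym (label-inL x')) (trans (label-map ρ ρ-pres e) (label-inL x)))))

    keepsR : JR.KeepsL ρ
    keepsR y with cover (to ρ (inR y))
    ... | inj₂ y'-e = y'-e
    ... | inj₁ (x , e) =
      let (x' , e') = keepsL (inverse ρ) ρ⁻-pres x
      in ⊥-elim (inL≢inR x' y (trans e' (≡-sym (inverse-maps ρ e))))

    keepsR-φ : ∀ {y y'} → inR y' ≡ to ρ (inR y) → proj₁ Φ' y' ≡ proj₁ Φ' y
    keepsR-φ {y} {y'} e = inject≤-injective d'≤D d'≤D _ _ (↑ˡ-injective N _ _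
      (trans (≡-sym (label-inR y')) (trans (label-map ρ ρ-pres e) (label-inR y))))

  distinguishing : Distinguishable G (D + N)
  distinguishing = label , λ ρ ρ-pres →
    let ρ⁻-pres = Preserves-inverse ρ ρ-pres
    in JL.elim (λ u → to ρ u ≡ u)
         (JL.fixes-inL (proj₂ Φ) ρ (keepsL ρ ρ-pres) (keepsL (inverse ρ) ρ⁻-pres)
           (λ x → keepsL-φ ρ ρ-pres (proj₂ (keepsL ρ ρ-pres x))))
         (JR.fixes-inL (proj₂ Φ') ρ (keepsR ρ ρ-pres) (keepsR (inverse ρ) ρ⁻-pres)
           (λ y → keepsR-φ ρ ρ-pres (proj₂ (keepsR ρ ρ-pres y))))

theorem2p5 : (G₁ G₂ : Graph) → ¬ Iso G₁ G₂
    → (P : SidePartition (G₁ ⊕ G₂) (inV₁ G₁ G₂))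
    → (Q : SidePartition (G₁ ⊕ G₂) (inV₂ G₁ G₂))
    → (d₁ d₂ d : ℕ) → IsDistNum G₁ d₁ → IsDistNum G₂ d₂ → IsDistNum (G₁ ⊕ G₂) d
    → (QZero G₁ G₂ P Q → d ≡ d₁ ⊔ d₂)
      × (¬ QZero G₁ G₂ P Q → (z N M : ℕ) → IsMaxSharedA G₁ G₂ P Q N → IsMaxSharedB G₁ G₂ P Q M
         → z ≡ N ⊓ M → d ≤ (d₁ ⊔ d₂) + z)
theorem2p5 G₁ G₂ _ P Q d₁ d₂ d D₁ D₂ DG@(_ , minimal) = part-i , part-ii
  where
    J = join-⊕ G₁ G₂
    D = d₁ ⊔ d₂
    open SidePartition using (cls)

    bound-L : ∀ N → (∀ i j → InducedIso (G₁ ⊕ G₂) (SidePartition.Part P i) (G₁ ⊕ G₂) (SidePartition.Part Q j)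
                           → classRank (cls P) i < N)
            → d ≤ D + N
    bound-L N shared = minimal _
      (JoinLabeling.distinguishing J P Q (proj₁ D₁) (proj₁ D₂) (m≤m⊔n d₁ d₂) (m≤n⊔m d₁ d₂) N shared)

    bound-R : ∀ M → (∀ j i → InducedIso (G₁ ⊕ G₂) (SidePartition.Part Q j) (G₁ ⊕ G₂) (SidePartition.Part P i)
                           → classRank (cls Q) j < M)
            → d ≤ D + M
    bound-R M shared = minimal _
      (JoinLabeling.distinguishing (swap J) Q P (proj₁ D₂) (proj₁ D₁) (m≤n⊔m d₁ d₂) (m≤m⊔n d₁ d₂) M shared)

    part-i : QZero G₁ G₂ P Q → d ≡ D
    part-i q≡0 = ≤-antisym
      (subst (d ≤_) (+-identityʳ D) (bound-L 0 λ i j iso → ⊥-elim (q≡0 (cls P i) (i , j , refl , iso))))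
      (⊔-lub (JoinProperties.distNum-L≤ J DG D₁) (JoinProperties.distNum-L≤ (swap J) DG D₂))

    part-ii : ¬ QZero G₁ G₂ P Q → (z N M : ℕ) → IsMaxSharedA G₁ G₂ P Q N → IsMaxSharedB G₁ G₂ P Q M
            → z ≡ N ⊓ M → d ≤ D + z
    part-ii _ _ N M (_ , max-n) (_ , max-m) refl = subst (d ≤_) (≡-sym (+-distribˡ-⊓ D N M)) (⊓-glb
      (bound-L N λ i j iso → <-≤-trans (classRank<classSize (cls P) i) (max-n (cls P i) (i , j , refl , iso)))
      (bound-R M λ j i iso → <-≤-trans (classRank<classSize (cls Q) j)
                                       (max-m (cls Q j) (i , j , refl , InducedIso-sym iso))))
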